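{- Let $A$ be any $\mathcal{L}(\Box,\mathbf{I})$-formula and let $L$ be any logic (set of $\mathcal{L}(\Box,\rhd)$-formulas closed under the rules of $\mathbf{IL}^-$) such that $\mathbf{IL}^-(\mathbf{J4})\subseteq L\subseteq\mathbf{IL}^-(\mathbf{J4},\mathbf{J5})$ or $\mathbf{IL}^-(\mathbf{J4})\subseteq L\subseteq\mathbf{IL}^-(\mathbf{J2})$. Then $L\vdash A$ iff $\mathbf{il}^-(\mathbf{I4})\vdash A$.
   Context: The language $\mathcal{L}(\Box,\rhd)$ consists of propositional variables, $\bot$, $\to$, unary $\Box$ and binary $\rhd$; other connectives as usual, $\Diamond A:\equiv\neg\Box\neg A$, $\mathbf{I}A:\equiv\top\rhd A$; $\mathcal{L}(\Box,\mathbf{I})$-formulas are those built from variables and $\bot$ by $\to$, $\Box$, $\mathbf{I}$. The logic $\mathbf{IL}^-$ has as axioms all tautologies, $\Box(A\to B)\to(\Box A\to\Box B)$, $\Box(\Box A\to A)\to\Box A$, $\mathbf{J3}$: $(A\rhd C)\land(B\rhd C)\to(A\lor B)\rhd C$, $\mathbf{J6}$: $\Box A\leftrightarrow(\neg A\rhd\bot)$; rules: Modus Ponens, Necessitation, from $A\to B$ infer $(C\rhd A)\to(C\rhd B)$, and from $A\to B$ infer $(B\rhd C)\to(A\rhd C)$. Schemata: $\mathbf{J2}$: $(A\rhd B)\land(B\rhd C)\to A\rhd C$; $\mathbf{J4}$: $A\rhd B\to(\Diamond A\to\Diamond B)$; $\mathbf{J5}$: $\Diamond A\rhd A$. $L(\Sigma_1,\dots,\Sigma_k)$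 is $L$ with schemata $\Sigma_i$ added as axioms; inclusions refer to sets of theorems. The logic $\mathbf{il}^-$ has as axioms all tautologies of $\mathcal{L}(\Box,\mathbf{I})$, $\Box(A\to B)\to(\Box A\to\Box B)$, $\Box(\Box A\to A)\to\Box A$, $\Box\bot\leftrightarrow\mathbf{I}\bot$; rules Modus Ponens, Necessitation, and from $A\to B$ infer $\mathbf{I}A\to\mathbf{I}B$. $\mathbf{I4}$ is the schema $\mathbf{I}A\land\Diamond\top\to\Diamond A$. -}

module Defs where

open import Data.Nat using (ℕ)
open import Data.Bool using (Bool; true; false; _∧_; not; _∨_)
open import Data.Product using (_×_; ∃; ∃-syntax; _,_)
open import Data.Sum using (_⊎_)
open import Relation.Binary.PropositionalEquality using (_≡_)

infixr 4 _⇒_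
infix 6 _▷_
infix 3 _⇔'_
infixr 5 _∧'_ _∨'_
infix 8 □_ ◇_

data Fm : Set where
  var : ℕ → Fm
  ⊥'  : Fm
  _⇒_ : Fm → Fm → Fm
  □_  : Fm → Fm
  _▷_ : Fm → Fm → Fm

¬' : Fm → Fm
¬' A = A ⇒ ⊥'

⊤' : Fm
⊤' = ⊥' ⇒ ⊥'

_∨'_ : Fm → Fm → Fm
A ∨' B = ¬' A ⇒ B

_∧'_ : Fm → Fm → Fm
A ∧' B = ¬' (A ⇒ ¬' B)

_⇔'_ : Fm → Fm → Fm
A ⇔' B = (A ⇒ B) ∧' (B ⇒ A)

◇_ : Fm → Fm
◇ A = ¬' (□ (¬' A))

implB : Bool → Bool → Bool
implB a b = not a ∨ b

evalF : (Fm → Bool) → Fm → Bool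
evalF v (var n) = v (var n)
evalF v ⊥' = false
evalF v (A ⇒ B) = implB (evalF v A) (evalF v B)
evalF v (□ A) = v (□ A)
evalF v (A ▷ B) = v (A ▷ B)

Taut : Fm → Set
Taut A = ∀ (v : Fm → Bool) → evalF v A ≡ true

J2 : Fm → Set
J2 F = ∃[ A ] ∃[ B ] ∃[ C ] F ≡ (((A ▷ B) ∧' (B ▷ C)) ⇒ (A ▷ C))

J4 : Fm → Set
J4 F = ∃[ A ] ∃[ B ] F ≡ ((A ▷ B) ⇒ ((◇ A) ⇒ (◇ B)))

J5 : Fm → Set
J5 F = ∃[ A ] F ≡ ((◇ A) ▷ A)

_∪_ : (Fm → Set) → (Fm → Set) → (Fm → Set)
(P ∪ Q) F = P F ⊎ Q F

data IL⁻ (Ax : Fm → Set) : Fm → Set where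
  ax    : ∀ {A} → Ax A → IL⁻ Ax A
  taut  : ∀ {A} → Taut A → IL⁻ Ax A
  axK   : ∀ A B → IL⁻ Ax (□ (A ⇒ B) ⇒ (□ A ⇒ □ B))
  axL   : ∀ A → IL⁻ Ax (□ (□ A ⇒ A) ⇒ □ A)
  axJ3  : ∀ A B C → IL⁻ Ax (((A ▷ C) ∧' (B ▷ C)) ⇒ ((A ∨' B) ▷ C))
  axJ6  : ∀ A → IL⁻ Ax (□ A ⇔' (¬' A ▷ ⊥'))
  mp    : ∀ {A B} → IL⁻ Ax (A ⇒ B) → IL⁻ Ax A → IL⁻ Ax B
  nec   : ∀ {A} → IL⁻ Ax A → IL⁻ Ax (□ A)
  ruleR1 : ∀ {A B} C → IL⁻ Ax (A ⇒ B) → IL⁻ Ax ((C ▷ A) ⇒ (C ▷ B))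
  ruleR2 : ∀ {A B} C → IL⁻ Ax (A ⇒ B) → IL⁻ Ax ((B ▷ C) ⇒ (A ▷ C))

ClosedUnderRules : (Fm → Set) → Set
ClosedUnderRules L =
    (∀ {A B} → L (A ⇒ B) → L A → L B)
  × (∀ {A} → L A → L (□ A))
  × (∀ {A B} C → L (A ⇒ B) → L ((C ▷ A) ⇒ (C ▷ B)))
  × (∀ {A B} C → L (A ⇒ B) → L ((B ▷ C) ⇒ (A ▷ C)))

_⊆_ : (Fm → Set) → (Fm → Set) → Set
P ⊆ Q = ∀ {F} → P F → Q F

infix 3 _⇔I_
infixr 5 _∧I_

data FmI : Set where
  var : ℕ → FmI
  ⊥'  : FmI
  _⇒_ : FmI → FmI → FmI
  □_  : FmI → FmI
  I   : FmI → FmI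

¬I : FmI → FmI
¬I A = A ⇒ ⊥'

⊤I : FmI
⊤I = ⊥' ⇒ ⊥'

_∧I_ : FmI → FmI → FmI
A ∧I B = ¬I (A ⇒ ¬I B)

_⇔I_ : FmI → FmI → FmI
A ⇔I B = (A ⇒ B) ∧I (B ⇒ A)

◇I : FmI → FmI
◇I A = ¬I (□ (¬I A))

evalI : (FmI → Bool) → FmI → Bool
evalI v (var n) = v (var n)
evalI v ⊥' = false
evalI v (A ⇒ B) = implB (evalI v A) (evalI v B)
evalI v (□ A) = v (□ A)
evalI v (I A) = v (I A)

TautI : FmI → Set
TautI A = ∀ (v : FmI → Bool) → evalI v A ≡ true

I4 : FmI → Set
I4 F = ∃[ A ] F ≡ ((I A ∧I ◇I ⊤I) ⇒ ◇I A)

data il⁻ (Ax : FmI → Set) : FmI → Set where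
  ax    : ∀ {A} → Ax A → il⁻ Ax A
  taut  : ∀ {A} → TautI A → il⁻ Ax A
  axK   : ∀ A B → il⁻ Ax (□ (A ⇒ B) ⇒ (□ A ⇒ □ B))
  axL   : ∀ A → il⁻ Ax (□ (□ A ⇒ A) ⇒ □ A)
  axI⊥  : il⁻ Ax (□ ⊥' ⇔I I ⊥')
  mp    : ∀ {A B} → il⁻ Ax (A ⇒ B) → il⁻ Ax A → il⁻ Ax B
  nec   : ∀ {A} → il⁻ Ax A → il⁻ Ax (□ A)
  ruleI : ∀ {A B} → il⁻ Ax (A ⇒ B) → il⁻ Ax (I A ⇒ I B)

emb : FmI → Fm
emb (var n) = var n
emb ⊥' = ⊥'
emb (A ⇒ B) = emb A ⇒ emb B
emb (□ A) = □ (emb A)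
emb (I A) = ⊤' ▷ emb A

-- il⁻(I4) embeds into IL⁻(J4), since I4 follows from the instance of J4 with A = ⊤.
-- Conversely, interpret A ▷ B inside L(□,I) by
--   ◇A → I B                 for IL⁻(J2),
--   ◇(A ∧ □¬B) → I B         for IL⁻(J4,J5).
-- Each interpretation maps theorems of the respective logic to theorems of il⁻(I4), and it
-- fixes L(□,I)-formulas up to provable equivalence: ⊤ ▷ B becomes ◇⊤ → I B (resp. ◇□¬B → I B),
-- and if the premise fails we have □⊥, hence I⊥, hence I B anyway.
module Submission where

open import Defs
open import Data.Bool using (Bool; true; false)
import Data.Bool as Bool
open import Data.Fin using (Fin; zero; suc)
open import Data.Nat using (ℕ; suc)
open import Data.Product using (_×_; _,_; proj₁; proj₂)
open import Data.Sum using (_⊎_; inj₁; inj₂)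
open import Data.Vec using (Vec; []; _∷_; lookup; map)
open import Data.Vec.Properties using (lookup-map)
open import Relation.Nullary.Decidable using (Dec; True; toWitness; map′; _×-dec_)
open import Relation.Binary.PropositionalEquality using (_≡_; refl; sym; trans; cong₂)

private variable
  n : ℕ
  Ax : FmI → Set

infixr 4 _⊃_
infixr 5 _&_

data Schema (n : ℕ) : Set where
  atom : Fin n → Schema n
  ⊥ₛ   : Schema n
  _⊃_  : Schema n → Schema n → Schema n

¬ₛ : Schema n → Schema n
¬ₛ a = a ⊃ ⊥ₛ

⊤ₛ : Schema n
⊤ₛ = ⊥ₛ ⊃ ⊥ₛ

_&_ : Schema n → Schema n → Schema n
a & b = ¬ₛ (a ⊃ ¬ₛ b)

_≡ₛ_ : Schema n → Schema n → Schema n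
a ≡ₛ b = (a ⊃ b) & (b ⊃ a)

p₀ : Schema (suc n)
p₀ = atom zero

p₁ : Schema (suc (suc n))
p₁ = atom (suc zero)

p₂ : Schema (suc (suc (suc n)))
p₂ = atom (suc (suc zero))

p₃ : Schema (suc (suc (suc (suc n))))
p₃ = atom (suc (suc (suc zero)))

p₄ : Schema (suc (suc (suc (suc (suc n)))))
p₄ = atom (suc (suc (suc (suc zero))))

p₅ : Schema (suc (suc (suc (suc (suc (suc n))))))
p₅ = atom (suc (suc (suc (suc (suc zero)))))

evalₛ : Vec Bool n → Schema n → Bool
evalₛ ρ (atom i) = lookup ρ i
evalₛ ρ ⊥ₛ = false
evalₛ ρ (a ⊃ b) = implB (evalₛ ρ a) (evalₛ ρ b)

Tautology : Schema n → Set
Tautology S = ∀ ρ → evalₛ ρ S ≡ true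

all-valuations? : {P : Vec Bool n → Set} → (∀ ρ → Dec (P ρ)) → Dec (∀ ρ → P ρ)
all-valuations? {n = 0} P? = map′ (λ { p [] → p }) (λ h → h []) (P? [])
all-valuations? {n = suc n} P? =
  map′ (λ { (t , f) (true ∷ ρ) → t ρ ; (t , f) (false ∷ ρ) → f ρ })
       (λ h → (λ ρ → h (true ∷ ρ)) , (λ ρ → h (false ∷ ρ)))
       (all-valuations? (λ ρ → P? (true ∷ ρ)) ×-dec all-valuations? (λ ρ → P? (false ∷ ρ)))

tautology? : (S : Schema n) → Dec (Tautology S)
tautology? S = all-valuations? (λ ρ → evalₛ ρ S Bool.≟ true)

instantiate : Vec FmI n → Schema n → FmI
instantiate σ (atom i) = lookup σ i
instantiate σ ⊥ₛ = ⊥'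
instantiate σ (a ⊃ b) = instantiate σ a ⇒ instantiate σ b

evalI-instantiate : ∀ v (σ : Vec FmI n) S →
                    evalI v (instantiate σ S) ≡ evalₛ (map (evalI v) σ) S
evalI-instantiate v σ (atom i) = sym (lookup-map i (evalI v) σ)
evalI-instantiate v σ ⊥ₛ = refl
evalI-instantiate v σ (a ⊃ b) = cong₂ implB (evalI-instantiate v σ a) (evalI-instantiate v σ b)

instantiate-tautology : ∀ (σ : Vec FmI n) S → Tautology S → TautI (instantiate σ S)
instantiate-tautology σ S t v = trans (evalI-instantiate v σ S) (t (map (evalI v) σ))

-- The implicit argument is discharged by evaluating the truth table of S during type checking.
decide-tautology : (S : Schema n) → {True (tautology? S)} → Tautology S
decide-tautology S {ok} = toWitness ok

taut⊢ : (σ : Vec FmI n) (S : Schema n) → {True (tautology? S)} → il⁻ Ax (instantiate σ S)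
taut⊢ σ S {ok} = taut (instantiate-tautology σ S (decide-tautology S {ok}))

mp₂ : ∀ {A B C} → il⁻ Ax (A ⇒ B ⇒ C) → il⁻ Ax A → il⁻ Ax B → il⁻ Ax C
mp₂ f a b = mp (mp f a) b

mp₃ : ∀ {A B C D} → il⁻ Ax (A ⇒ B ⇒ C ⇒ D) → il⁻ Ax A → il⁻ Ax B → il⁻ Ax C → il⁻ Ax D
mp₃ f a b c = mp (mp₂ f a b) c

mp₄ : ∀ {A B C D E} → il⁻ Ax (A ⇒ B ⇒ C ⇒ D ⇒ E) →
      il⁻ Ax A → il⁻ Ax B → il⁻ Ax C → il⁻ Ax D → il⁻ Ax E
mp₄ f a b c d = mp (mp₃ f a b c) d

⇒-refl : ∀ A → il⁻ Ax (A ⇒ A)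
⇒-refl A = taut⊢ (A ∷ []) (p₀ ⊃ p₀)

⇒-trans : ∀ {A B C} → il⁻ Ax (A ⇒ B) → il⁻ Ax (B ⇒ C) → il⁻ Ax (A ⇒ C)
⇒-trans {A = A} {B} {C} = mp₂ (taut⊢ (A ∷ B ∷ C ∷ []) ((p₀ ⊃ p₁) ⊃ (p₁ ⊃ p₂) ⊃ (p₀ ⊃ p₂)))

contrapose : ∀ {A B} → il⁻ Ax (A ⇒ B) → il⁻ Ax (¬I B ⇒ ¬I A)
contrapose {A = A} {B} = mp (taut⊢ (A ∷ B ∷ []) ((p₀ ⊃ p₁) ⊃ (¬ₛ p₁ ⊃ ¬ₛ p₀)))

□-mono : ∀ {A B} → il⁻ Ax (A ⇒ B) → il⁻ Ax (□ A ⇒ □ B)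
□-mono {A = A} {B} d = mp (axK A B) (nec d)

□-mono₂ : ∀ {A B C} → il⁻ Ax (A ⇒ B ⇒ C) → il⁻ Ax (□ A ⇒ □ B ⇒ □ C)
□-mono₂ {B = B} {C} d = ⇒-trans (□-mono d) (axK B C)

◇-mono : ∀ {A B} → il⁻ Ax (A ⇒ B) → il⁻ Ax (◇I A ⇒ ◇I B)
◇-mono d = contrapose (□-mono (contrapose d))

□⇒◇⇒◇ : ∀ A B → il⁻ Ax (□ (A ⇒ B) ⇒ ◇I A ⇒ ◇I B)
□⇒◇⇒◇ A B =
  mp (taut⊢ (□ (A ⇒ B) ∷ □ (¬I B) ∷ □ (¬I A) ∷ [])
            ((p₀ ⊃ p₁ ⊃ p₂) ⊃ (p₀ ⊃ ¬ₛ p₂ ⊃ ¬ₛ p₁)))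
     (□-mono₂ (taut⊢ (A ∷ B ∷ []) ((p₀ ⊃ p₁) ⊃ ¬ₛ p₁ ⊃ ¬ₛ p₀)))

-- Transitivity, derived from Löb's axiom for □(A ∧ □A).
□⇒□□ : ∀ A → il⁻ Ax (□ A ⇒ □ (□ A))
□⇒□□ A = ⇒-trans (⇒-trans (□-mono A⇒□B⇒B) (axL B))
                 (□-mono (taut⊢ (A ∷ □ A ∷ []) ((p₀ & p₁) ⊃ p₁)))
  where
  B = A ∧I □ A
  A⇒□B⇒B : il⁻ _ (A ⇒ □ B ⇒ B)
  A⇒□B⇒B = mp (taut⊢ (A ∷ □ A ∷ □ B ∷ []) ((p₂ ⊃ p₁) ⊃ p₀ ⊃ p₂ ⊃ (p₀ & p₁)))
              (□-mono (taut⊢ (A ∷ □ A ∷ []) ((p₀ & p₁) ⊃ p₀)))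

◇◇⇒◇ : ∀ A → il⁻ Ax (◇I (◇I A) ⇒ ◇I A)
◇◇⇒◇ A = contrapose (⇒-trans (□⇒□□ (¬I A))
                              (□-mono (taut⊢ (□ (¬I A) ∷ []) (p₀ ⊃ ¬ₛ (¬ₛ p₀)))))

□⊥⇒□ : ∀ A → il⁻ Ax (□ ⊥' ⇒ □ A)
□⊥⇒□ A = □-mono (taut⊢ (A ∷ []) (⊥ₛ ⊃ p₀))

I⊥⇒I : ∀ A → il⁻ Ax (I ⊥' ⇒ I A)
I⊥⇒I A = ruleI (taut⊢ (A ∷ []) (⊥ₛ ⊃ p₀))

□⊥⇒I⊥ : il⁻ Ax (□ ⊥' ⇒ I ⊥')
□⊥⇒I⊥ = mp (taut⊢ (□ ⊥' ∷ I ⊥' ∷ []) ((p₀ ≡ₛ p₁) ⊃ (p₀ ⊃ p₁))) axI⊥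

I⊥⇒□⊥ : il⁻ Ax (I ⊥' ⇒ □ ⊥')
I⊥⇒□⊥ = mp (taut⊢ (□ ⊥' ∷ I ⊥' ∷ []) ((p₀ ≡ₛ p₁) ⊃ (p₁ ⊃ p₀))) axI⊥

□⊥⇒I : ∀ A → il⁻ Ax (□ ⊥' ⇒ I A)
□⊥⇒I A = ⇒-trans □⊥⇒I⊥ (I⊥⇒I A)

⇒-cong : ∀ {A A′ B B′} → il⁻ Ax (A′ ⇒ A) → il⁻ Ax (B ⇒ B′) → il⁻ Ax ((A ⇒ B) ⇒ (A′ ⇒ B′))
⇒-cong {A = A} {A′} {B} {B′} =
  mp₂ (taut⊢ (A ∷ A′ ∷ B ∷ B′ ∷ []) ((p₁ ⊃ p₀) ⊃ (p₂ ⊃ p₃) ⊃ (p₀ ⊃ p₂) ⊃ (p₁ ⊃ p₃)))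

translate : (FmI → FmI → FmI) → Fm → FmI
translate D (var n) = var n
translate D ⊥' = ⊥'
translate D (A ⇒ B) = translate D A ⇒ translate D B
translate D (□ A) = □ translate D A
translate D (A ▷ B) = D (translate D A) (translate D B)

evalF-translate : ∀ D v F → evalF (λ X → evalI v (translate D X)) F ≡ evalI v (translate D F)
evalF-translate D v (var n) = refl
evalF-translate D v ⊥' = refl
evalF-translate D v (A ⇒ B) = cong₂ implB (evalF-translate D v A) (evalF-translate D v B)
evalF-translate D v (□ A) = refl
evalF-translate D v (A ▷ B) = refl

translate-taut : ∀ D F → Taut F → TautI (translate D F)
translate-taut D F t v = trans (sym (evalF-translate D v F)) (t (λ X → evalI v (translate D X)))

record Interpretation (Ax : FmI → Set) (D : FmI → FmI → FmI) (Σ : Fm → Set) : Set where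
  field
    J3 : ∀ A B C → il⁻ Ax ((D A C ∧I D B C) ⇒ D (¬I A ⇒ B) C)
    J6 : ∀ A → il⁻ Ax (□ A ⇔I D (¬I A) ⊥')
    R1 : ∀ {A B} C → il⁻ Ax (A ⇒ B) → il⁻ Ax (D C A ⇒ D C B)
    R2 : ∀ {A B} C → il⁻ Ax (A ⇒ B) → il⁻ Ax (D B C ⇒ D A C)
    extra-axioms : ∀ {F} → Σ F → il⁻ Ax (translate D F)

module _ {D Σ} (interp : Interpretation Ax D Σ) where
  open Interpretation interp

  translate-sound : ∀ {F} → IL⁻ Σ F → il⁻ Ax (translate D F)
  translate-sound (ax σ) = extra-axioms σ
  translate-sound (taut {F} t) = taut (translate-taut D F t)
  translate-sound (axK _ _) = axK _ _
  translate-sound (axL _) = axL _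
  translate-sound (axJ3 _ _ _) = J3 _ _ _
  translate-sound (axJ6 _) = J6 _
  translate-sound (mp d e) = mp (translate-sound d) (translate-sound e)
  translate-sound (nec d) = nec (translate-sound d)
  translate-sound (ruleR1 _ d) = R1 _ (translate-sound d)
  translate-sound (ruleR2 _ d) = R2 _ (translate-sound d)

-- translate D ⊤' reduces to ⊤I, so the case of I needs exactly this hypothesis on D ⊤I.
translate-emb : ∀ D → (∀ X → il⁻ Ax (D ⊤I X ⇒ I X) × il⁻ Ax (I X ⇒ D ⊤I X)) →
                ∀ A → il⁻ Ax (translate D (emb A) ⇒ A) × il⁻ Ax (A ⇒ translate D (emb A))
translate-emb D D⊤≈I (var n) = ⇒-refl _ , ⇒-refl _
translate-emb D D⊤≈I ⊥' = ⇒-refl _ , ⇒-refl _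
translate-emb D D⊤≈I (A ⇒ B) with translate-emb D D⊤≈I A | translate-emb D D⊤≈I B
... | A*⇒A , A⇒A* | B*⇒B , B⇒B* = ⇒-cong A⇒A* B*⇒B , ⇒-cong A*⇒A B⇒B*
translate-emb D D⊤≈I (□ A) with translate-emb D D⊤≈I A
... | A*⇒A , A⇒A* = □-mono A*⇒A , □-mono A⇒A*
translate-emb D D⊤≈I (I A) with translate-emb D D⊤≈I A
... | A*⇒A , A⇒A* = ⇒-trans (proj₁ (D⊤≈I _)) (ruleI A*⇒A) , ⇒-trans (ruleI A⇒A*) (proj₂ (D⊤≈I _))

guarded : FmI → FmI → FmI
guarded Z Y = ¬I (□ Z) ⇒ I Y

guarded-mono : ∀ {Z Z′ X Y} → il⁻ Ax (Z ⇒ Z′) → il⁻ Ax (X ⇒ Y) →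
               il⁻ Ax (guarded Z X ⇒ guarded Z′ Y)
guarded-mono {Z = Z} {Z′} {X} {Y} Z⇒Z′ X⇒Y =
  mp₂ (taut⊢ (□ Z ∷ □ Z′ ∷ I X ∷ I Y ∷ [])
             ((p₀ ⊃ p₁) ⊃ (p₂ ⊃ p₃) ⊃ ((¬ₛ p₀ ⊃ p₂) ⊃ (¬ₛ p₁ ⊃ p₃))))
      (□-mono Z⇒Z′) (ruleI X⇒Y)

guarded-∨ : ∀ {Z₁ Z₂ Z C} → il⁻ Ax (Z₁ ⇒ Z₂ ⇒ Z) →
            il⁻ Ax ((guarded Z₁ C ∧I guarded Z₂ C) ⇒ guarded Z C)
guarded-∨ {Z₁ = Z₁} {Z₂} {Z} {C} d =
  mp (taut⊢ (□ Z₁ ∷ □ Z₂ ∷ □ Z ∷ I C ∷ [])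
            ((p₀ ⊃ p₁ ⊃ p₂) ⊃ (((¬ₛ p₀ ⊃ p₃) & (¬ₛ p₁ ⊃ p₃)) ⊃ (¬ₛ p₂ ⊃ p₃))))
     (□-mono₂ d)

-- The disjunct I⊥ of guarded Z ⊥ = □Z ∨ I⊥ is redundant, as I⊥ → □⊥ → □A.
guarded-□ : ∀ {A Z} → il⁻ Ax (A ⇒ Z) → il⁻ Ax (Z ⇒ A) → il⁻ Ax (□ A ⇔I guarded Z ⊥')
guarded-□ {A = A} {Z} A⇒Z Z⇒A =
  mp₃ (taut⊢ (□ A ∷ □ Z ∷ I ⊥' ∷ [])
             ((p₀ ⊃ p₁) ⊃ (p₁ ⊃ p₀) ⊃ (p₂ ⊃ p₀) ⊃ (p₀ ≡ₛ (¬ₛ p₁ ⊃ p₂))))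
      (□-mono A⇒Z) (□-mono Z⇒A) (⇒-trans I⊥⇒□⊥ (□⊥⇒□ A))

guarded-I : ∀ {Z X} → il⁻ Ax (□ Z ⇒ □ ⊥') →
            il⁻ Ax (guarded Z X ⇒ I X) × il⁻ Ax (I X ⇒ guarded Z X)
guarded-I {Z = Z} {X} □Z⇒□⊥ =
  mp₂ (taut⊢ (□ Z ∷ I X ∷ []) ((p₀ ⊃ p₁) ⊃ (p₁ ⊃ p₁) ⊃ ((¬ₛ p₀ ⊃ p₁) ⊃ p₁)))
      (⇒-trans □Z⇒□⊥ (□⊥⇒I X)) (⇒-refl _) ,
  taut⊢ (□ Z ∷ I X ∷ []) (p₁ ⊃ (¬ₛ p₀ ⊃ p₁))

▷-J2 : FmI → FmI → FmI
▷-J2 X Y = guarded (¬I X) Y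

▷-J45 : FmI → FmI → FmI
▷-J45 X Y = guarded (X ⇒ ◇I Y) Y

J2-interpretation : Interpretation I4 ▷-J2 J2
J2-interpretation = record
  { J3 = λ A B _ → guarded-∨ (taut⊢ (A ∷ B ∷ []) (¬ₛ p₀ ⊃ ¬ₛ p₁ ⊃ ¬ₛ (¬ₛ p₀ ⊃ p₁)))
  ; J6 = λ A → guarded-□ (taut⊢ (A ∷ []) (p₀ ⊃ ¬ₛ (¬ₛ p₀))) (taut⊢ (A ∷ []) (¬ₛ (¬ₛ p₀) ⊃ p₀))
  ; R1 = λ _ A⇒B → guarded-mono (⇒-refl _) A⇒B
  ; R2 = λ _ A⇒B → guarded-mono (contrapose A⇒B) (⇒-refl _)
  ; extra-axioms = J2-sound
  }
  where
  -- ◇A → I B and ◇B → I C give ◇A → I C: when ◇B fails, I4 (with ◇⊤ from ◇A) refutes I B.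
  J2-sound : ∀ {F} → J2 F → il⁻ I4 (translate ▷-J2 F)
  J2-sound (A , B , C , refl) =
    mp₂ (taut⊢ (I b ∷ □ (¬I ⊤I) ∷ □ (¬I b) ∷ □ (¬I a) ∷ I c ∷ [])
               (((p₀ & ¬ₛ p₁) ⊃ ¬ₛ p₂) ⊃ (p₁ ⊃ p₃) ⊃
                (((¬ₛ p₃ ⊃ p₀) & (¬ₛ p₂ ⊃ p₄)) ⊃ (¬ₛ p₃ ⊃ p₄))))
        (ax (b , refl)) (□-mono (taut⊢ (a ∷ []) (¬ₛ ⊤ₛ ⊃ ¬ₛ p₀)))
    where
    a = translate ▷-J2 A
    b = translate ▷-J2 B
    c = translate ▷-J2 C

J45-interpretation : Interpretation I4 ▷-J45 (J4 ∪ J5)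
J45-interpretation = record
  { J3 = λ A B C → guarded-∨ (taut⊢ (A ∷ B ∷ ◇I C ∷ [])
                                    ((p₀ ⊃ p₂) ⊃ (p₁ ⊃ p₂) ⊃ ((¬ₛ p₀ ⊃ p₁) ⊃ p₂)))
  ; J6 = λ A → guarded-□ (taut⊢ (A ∷ ◇I ⊥' ∷ []) (p₀ ⊃ ¬ₛ p₀ ⊃ p₁))
                          (mp (taut⊢ (A ∷ □ (¬I ⊥') ∷ []) (p₁ ⊃ (¬ₛ p₀ ⊃ ¬ₛ p₁) ⊃ p₀))
                              (nec (⇒-refl ⊥')))
  ; R1 = λ {A} {B} C A⇒B →
           guarded-mono (mp (taut⊢ (C ∷ ◇I A ∷ ◇I B ∷ []) ((p₁ ⊃ p₂) ⊃ (p₀ ⊃ p₁) ⊃ (p₀ ⊃ p₂)))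
                            (◇-mono A⇒B))
                        A⇒B
  ; R2 = λ {A} {B} C A⇒B →
           guarded-mono (mp (taut⊢ (A ∷ B ∷ ◇I C ∷ []) ((p₀ ⊃ p₁) ⊃ (p₁ ⊃ p₂) ⊃ (p₀ ⊃ p₂))) A⇒B)
                        (⇒-refl _)
  ; extra-axioms = J45-sound
  }
  where
  J45-sound : ∀ {F} → (J4 ∪ J5) F → il⁻ I4 (translate ▷-J45 F)
  -- If ◇A and □(A → ◇B), then ◇◇B, so ◇B; otherwise ◇A gives ◇⊤ and I4 turns I B into ◇B.
  J45-sound (inj₁ (A , B , refl)) =
    mp₄ (taut⊢ (□ (a ⇒ ◇I b) ∷ ◇I a ∷ ◇I (◇I b) ∷ ◇I b ∷ ◇I ⊤I ∷ I b ∷ [])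
               ((p₀ ⊃ p₁ ⊃ p₂) ⊃ (p₂ ⊃ p₃) ⊃ (p₁ ⊃ p₄) ⊃ ((p₅ & p₄) ⊃ p₃) ⊃
                ((¬ₛ p₀ ⊃ p₅) ⊃ p₁ ⊃ p₃)))
        (□⇒◇⇒◇ a (◇I b)) (◇◇⇒◇ b) (◇-mono (taut⊢ (a ∷ []) (p₀ ⊃ ⊤ₛ))) (ax (b , refl))
    where
    a = translate ▷-J45 A
    b = translate ▷-J45 B
  -- The guard □(◇A → ◇A) of ◇A ▷ A is a theorem.
  J45-sound (inj₂ (A , refl)) =
    mp (taut⊢ (□ (◇I a ⇒ ◇I a) ∷ I a ∷ []) (p₀ ⊃ ¬ₛ p₀ ⊃ p₁)) (nec (⇒-refl _))
    where
    a = translate ▷-J45 A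

J2-interpretation-on-I : ∀ X → il⁻ Ax (▷-J2 ⊤I X ⇒ I X) × il⁻ Ax (I X ⇒ ▷-J2 ⊤I X)
J2-interpretation-on-I X = guarded-I (□-mono (taut⊢ [] (¬ₛ ⊤ₛ ⊃ ⊥ₛ)))

-- The guard of ⊤ ▷ X yields □◇⊤, hence □(□⊥ → ⊥), hence □⊥ by Löb.
J45-interpretation-on-I : ∀ X → il⁻ Ax (▷-J45 ⊤I X ⇒ I X) × il⁻ Ax (I X ⇒ ▷-J45 ⊤I X)
J45-interpretation-on-I X = guarded-I (⇒-trans (⇒-trans □⊤⇒◇X⇒□◇⊤ □◇⊤⇒□[□⊥⇒⊥]) (axL ⊥'))
  where
  □⊤⇒◇X⇒□◇⊤ : il⁻ _ (□ (⊤I ⇒ ◇I X) ⇒ □ (◇I ⊤I))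
  □⊤⇒◇X⇒□◇⊤ = □-mono (mp (taut⊢ (◇I X ∷ ◇I ⊤I ∷ []) ((p₀ ⊃ p₁) ⊃ (⊤ₛ ⊃ p₀) ⊃ p₁))
                         (◇-mono (taut⊢ (X ∷ []) (p₀ ⊃ ⊤ₛ))))
  □◇⊤⇒□[□⊥⇒⊥] : il⁻ _ (□ (◇I ⊤I) ⇒ □ (□ ⊥' ⇒ ⊥'))
  □◇⊤⇒□[□⊥⇒⊥] = □-mono (contrapose (□⊥⇒□ (¬I ⊤I)))

evalF-emb : ∀ v A → evalF v (emb A) ≡ evalI (λ X → v (emb X)) A
evalF-emb v (var n) = refl
evalF-emb v ⊥' = refl
evalF-emb v (A ⇒ B) = cong₂ implB (evalF-emb v A) (evalF-emb v B)
evalF-emb v (□ A) = refl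
evalF-emb v (I A) = refl

emb-taut : ∀ A → TautI A → Taut (emb A)
emb-taut A t v = trans (evalF-emb v A) (t (λ X → v (emb X)))

emb-sound : ∀ {A} → il⁻ I4 A → IL⁻ J4 (emb A)
emb-sound (ax (B , refl)) =
  mp (taut (emb-taut (instantiate σ S) (instantiate-tautology σ S (decide-tautology S))))
     (ax (⊤' , emb B , refl))
  where
  σ = I B ∷ ◇I ⊤I ∷ ◇I B ∷ []
  S = (p₀ ⊃ p₁ ⊃ p₂) ⊃ ((p₀ & p₁) ⊃ p₂)
emb-sound (taut {A} t) = taut (emb-taut A t)
emb-sound (axK _ _) = axK _ _
emb-sound (axL _) = axL _
emb-sound axI⊥ = axJ6 ⊥'
emb-sound (mp d e) = mp (emb-sound d) (emb-sound e)
emb-sound (nec d) = nec (emb-sound d)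
emb-sound (ruleI d) = ruleR1 ⊤' (emb-sound d)

emb-reflects : ∀ {D Σ} → Interpretation Ax D Σ →
               (∀ X → il⁻ Ax (D ⊤I X ⇒ I X) × il⁻ Ax (I X ⇒ D ⊤I X)) →
               ∀ A → IL⁻ Σ (emb A) → il⁻ Ax A
emb-reflects {D = D} interp D⊤≈I A d =
  mp (proj₁ (translate-emb D D⊤≈I A)) (translate-sound interp d)

corollary4p14 : (L : Fm → Set) → ClosedUnderRules L →
    ((IL⁻ J4 ⊆ L × L ⊆ IL⁻ (J4 ∪ J5)) ⊎ (IL⁻ J4 ⊆ L × L ⊆ IL⁻ J2)) →
    (A : FmI) → (L (emb A) → il⁻ I4 A) × (il⁻ I4 A → L (emb A))
corollary4p14 _ _ (inj₁ (J4⊆L , L⊆J45)) A =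
  (λ ⊢A → emb-reflects J45-interpretation J45-interpretation-on-I A (L⊆J45 ⊢A)) ,
  (λ ⊢A → J4⊆L (emb-sound ⊢A))
corollary4p14 _ _ (inj₂ (J4⊆L , L⊆J2)) A =
  (λ ⊢A → emb-reflects J2-interpretation J2-interpretation-on-I A (L⊆J2 ⊢A)) ,
  (λ ⊢A → J4⊆L (emb-sound ⊢A))
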